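{- Let $r,n\ge1$ and $\sigma=(z,\tau)\in G_{r,n}$, viewed as a permutation of $\Sigma=\{i^{[j]}: i\in[n],\,0\le j\le r-1\}$ via $\sigma(i^{[j]})=\tau(i)^{[(j+z_i)\bmod r]}$. Order $\Sigma$ by the color order. Then $$\#\{x\in\Sigma:\sigma(x)>x\}=r\cdot\mathrm{exc}_A(\sigma)+\mathrm{csum}(\sigma).$$
   Context: $G_{r,n}$ is the set of pairs $(z,\tau)$ with $z=(z_1,\dots,z_n)\in\{0,\dots,r-1\}^n$ and $\tau\in S_n$. $i^{[j]}$ denotes the element $i$ with color $j$; $i^{[0]}$ is identified with $i$. The color order on $\Sigma$: $i^{[j]}<k^{[l]}$ iff $j>l$, or $j=l$ and $i<k$; i.e. $1^{[r-1]}<\cdots<n^{[r-1]}<1^{[r-2]}<\cdots<n^{[r-2]}<\cdots<1<\cdots<n$. $\mathrm{csum}(\sigma)=\sum_{i=1}^n z_i$ (as integers) and $\mathrm{exc}_A(\sigma)=\#\{i\in[n-1]:\sigma(i)>i\text{ in the color order}\}=\#\{i\in[n-1]: z_i=0,\ \tau(i)>i\}$. -}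

module Defs where

open import Data.Nat using (ℕ; NonZero; _∸_)
import Data.Nat as ℕ
open import Data.Nat.DivMod using (_%_; m%n<n)
open import Data.Fin using (Fin; toℕ; fromℕ<; _<_)
open import Data.Fin.Properties using (_≟_; _<?_)
open import Data.Fin.Permutation using (Permutation′; _⟨$⟩ʳ_)
open import Data.Product using (_×_; _,_; Σ)
open import Data.Sum using (_⊎_)
open import Data.List using (List; length; filter; map; allFin; cartesianProduct)
open import Data.Nat.ListAction using (sum)
open import Relation.Binary.PropositionalEquality using (_≡_)
open import Relation.Nullary using (Dec)
open import Relation.Nullary.Decidable using (_⊎-dec_; _×-dec_)

-- An element of G_{r,n}: a color vector z ∈ {0..r-1}^n and τ ∈ S_n.
-- (Elements of [n] are represented 0-based by Fin n.)
G : ℕ → ℕ → Set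
G r n = (Fin n → Fin r) × Permutation′ n

-- Σ = { i^[j] } represented as pairs (i , j) : Fin n × Fin r  (i = letter, j = color).
Sig : ℕ → ℕ → Set
Sig r n = Fin n × Fin r

_<c_ : ∀ {r n} → Sig r n → Sig r n → Set
(i , j) <c (k , l) = (l < j) ⊎ ((j ≡ l) × (i < k))

_<c?_ : ∀ {r n} (x y : Sig r n) → Dec (x <c y)
(i , j) <c? (k , l) = (l <? j) ⊎-dec ((j ≟ l) ×-dec (i <? k))

act : ∀ {r n} .{{_ : NonZero r}} → G r n → Sig r n → Sig r n
act {r} (z , τ) (i , j) =
  (τ ⟨$⟩ʳ i , fromℕ< (m%n<n (toℕ j ℕ.+ toℕ (z i)) r))

allSig : ∀ r n → List (Sig r n)
allSig r n = cartesianProduct (allFin n) (allFin r)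

excΣ : ∀ {r n} .{{_ : NonZero r}} → G r n → ℕ
excΣ {r} {n} σ = length (filter (λ x → x <c? act σ x) (allSig r n))

csum : ∀ {r n} → G r n → ℕ
csum {r} {n} (z , τ) = sum (map (λ i → toℕ (z i)) (allFin n))

-- σ(i) for i ∈ [n] (= i^[0]) is τ(i)^[z_i]
actA : ∀ {r n} → G r n → Fin n → Sig r n
actA (z , τ) i = (τ ⟨$⟩ʳ i , z i)

-- exc_A(σ) = #{ i ∈ [n-1] : σ(i) > i in the color order }, where i = i^[0].
-- 0-based: i ranges over Fin n with toℕ i < n ∸ 1.
excA : ∀ {r n} .{{_ : NonZero r}} → G r n → ℕ
excA {r} {n} σ =
  length (filter (λ i → (toℕ i ℕ.<? (n ∸ 1)) ×-dec ((i , zeroC) <c? actA σ i)) (allFin n))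
  where
  zeroC : Fin r
  zeroC = fromℕ< (m%n<n 0 r)

-- Count the x = i^[j] with σ(x) > x letter by letter; put c = z_i. If c = 0, σ keeps the colour
-- of every i^[j], so σ(i^[j]) > i^[j] exactly when i < τ(i): r such x when i is an A-excedance
-- (i < n - 1 is then automatic) and none otherwise. If c ≠ 0 the colour changes, and since a larger
-- colour is a smaller element, σ(i^[j]) > i^[j] exactly when j + c wraps around modulo r, which
-- happens for exactly c of the r colours j. Summing over i gives r · exc_A(σ) + csum(σ).
module Submission where

open import Defs
open import Data.Bool using (true; false)
open import Data.Fin as Fin using (Fin; toℕ; fromℕ<)
open import Data.Fin.Permutation using (Permutation′; _⟨$⟩ʳ_)
open import Data.Fin.Properties using (toℕ-fromℕ<; toℕ-injective; toℕ<n)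
open import Data.List using (List; []; _∷_; [_]; _++_; length; filter; map; allFin; tabulate; cartesianProduct)
open import Data.List.Properties using (length-++; length-tabulate; map-tabulate; filter-++; filter-≐; filter-all; filter-none; filter-reject)
open import Data.List.Relation.Unary.All.Properties using (tabulate⁺)
open import Data.Nat using (ℕ; NonZero; _+_; _*_; _≤_; suc; s≤s; s≤s⁻¹; _∸_; _<_; _≤?_; _≟_; _<?_; >-nonZero⁻¹)
open import Data.Nat.DivMod using (_%_; m%n<n; m<n⇒m%n≡m; m≤n⇒[n∸m]%m≡n%m)
open import Data.Nat.ListAction using (sum)
open import Data.Nat.Properties
open import Algebra.Properties.CommutativeSemigroup +-commutativeSemigroup using (interchange)
open import Data.Product using (_×_; _,_; proj₁; proj₂)
open import Data.Sum using (inj₁; inj₂)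
open import Function using (_∘_; id)
open import Level using (Level; 0ℓ)
open import Relation.Binary.PropositionalEquality using (_≡_; refl; sym; trans; cong; cong₂; subst; module ≡-Reasoning)
open import Relation.Nullary using (yes; no; does; ¬_; contradiction)
open import Relation.Nullary.Decidable using (_×-dec_)
open import Relation.Unary using (Pred; Decidable; _≐_)

private
  variable
    a b p q : Level
    A : Set a
    B : Set b

count : {P : Pred A p} → Decidable P → List A → ℕ
count P? xs = length (filter P? xs)

module _ {P : Pred A p} (P? : Decidable P) where

  count-++ : ∀ xs ys → count P? (xs ++ ys) ≡ count P? xs + count P? ys
  count-++ xs ys = trans (cong length (filter-++ P? xs ys)) (length-++ (filter P? xs))

  count-map : (f : B → A) (xs : List B) → count P? (map f xs) ≡ count (P? ∘ f) xs
  count-map f []       = refl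
  count-map f (x ∷ xs) with does (P? (f x))
  ... | true  = cong suc (count-map f xs)
  ... | false = count-map f xs

  count-[x]-no : ∀ {x} → ¬ P x → count P? [ x ] ≡ 0
  count-[x]-no ¬px = cong length (filter-reject P? ¬px)

module _ {n : ℕ} {P : Pred (Fin n) p} (P? : Decidable P) where

  count-allFin-all : (∀ i → P i) → count P? (allFin n) ≡ n
  count-allFin-all all = trans (cong length (filter-all P? (tabulate⁺ all))) (length-tabulate id)

  count-allFin-none : (∀ i → ¬ P i) → count P? (allFin n) ≡ 0
  count-allFin-none none = cong length (filter-none P? (tabulate⁺ none))

count-≐ : {P : Pred A p} {Q : Pred A q} (P? : Decidable P) (Q? : Decidable Q) →
          P ≐ Q → ∀ xs → count P? xs ≡ count Q? xs
count-≐ P? Q? P≐Q xs = cong length (filter-≐ P? Q? P≐Q xs)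

count-allFin-const : ∀ {m} {P : Pred (Fin m) p} (P? : Decidable P) {Q : Pred A q} (Q? : Decidable Q) {x : A} →
                     (∀ j → P j → Q x) → (∀ j → Q x → P j) → count P? (allFin m) ≡ m * count Q? [ x ]
count-allFin-const {m = m} P? Q? {x} to from with Q? x
... | yes qx = trans (count-allFin-all P? (λ j → from j qx)) (sym (*-identityʳ m))
... | no ¬qx = trans (count-allFin-none P? (λ j → ¬qx ∘ to j)) (sym (*-zeroʳ m))

count-cartesianProduct : {P : Pred (A × B) p} (P? : Decidable P) {Q : Pred A q} (Q? : Decidable Q)
                         (k : ℕ) (f : A → ℕ) (ys : List B) →
                         (∀ x → count P? (map (x ,_) ys) ≡ k * count Q? [ x ] + f x) →
                         ∀ xs → count P? (cartesianProduct xs ys) ≡ k * count Q? xs + sum (map f xs)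
count-cartesianProduct P? Q? k f ys fibre []       = sym (trans (+-identityʳ (k * 0)) (*-zeroʳ k))
count-cartesianProduct P? Q? k f ys fibre (x ∷ xs) = begin
  count P? (map (x ,_) ys ++ cartesianProduct xs ys)
    ≡⟨ count-++ P? (map (x ,_) ys) (cartesianProduct xs ys) ⟩
  count P? (map (x ,_) ys) + count P? (cartesianProduct xs ys)
    ≡⟨ cong₂ _+_ (fibre x) (count-cartesianProduct P? Q? k f ys fibre xs) ⟩
  (k * count Q? [ x ] + f x) + (k * count Q? xs + sum (map f xs))
    ≡⟨ interchange (k * count Q? [ x ]) (f x) (k * count Q? xs) (sum (map f xs)) ⟩
  (k * count Q? [ x ] + k * count Q? xs) + (f x + sum (map f xs))
    ≡⟨ cong (_+ sum (map f (x ∷ xs))) (sym (*-distribˡ-+ k (count Q? [ x ]) (count Q? xs))) ⟩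
  k * (count Q? [ x ] + count Q? xs) + sum (map f (x ∷ xs))
    ≡⟨ cong (λ m → k * m + sum (map f (x ∷ xs))) (count-++ Q? [ x ] xs) ⟨
  k * count Q? (x ∷ xs) + sum (map f (x ∷ xs)) ∎
  where open ≡-Reasoning

count-wraps : ∀ m c → c ≤ m → count (λ (j : Fin m) → m ≤? toℕ j + c) (allFin m) ≡ c
count-wraps m c c≤m with m≤n⇒m<n∨m≡n c≤m
... | inj₂ refl = count-allFin-all (λ j → m ≤? toℕ j + m) (λ j → m≤n+m m (toℕ j))
count-wraps (suc m) c _ | inj₁ (s≤s c≤m) = begin
  count P? (allFin (suc m))             ≡⟨ cong length (filter-reject P? (<⇒≱ (s≤s c≤m))) ⟩
  count P? (tabulate Fin.suc)           ≡⟨ cong (count P?) (map-tabulate id Fin.suc) ⟨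
  count P? (map Fin.suc (allFin m))     ≡⟨ count-map P? Fin.suc (allFin m) ⟩
  count (P? ∘ Fin.suc) (allFin m)       ≡⟨ count-≐ (P? ∘ Fin.suc) Q? (s≤s⁻¹ , s≤s) (allFin m) ⟩
  count Q? (allFin m)                   ≡⟨ count-wraps m c c≤m ⟩
  c                                     ∎
  where
  open ≡-Reasoning
  P? = λ (j : Fin (suc m)) → suc m ≤? toℕ j + c
  Q? = λ (j : Fin m) → m ≤? toℕ j + c

m+n∸o<m : ∀ {m n o} → n < o → o ≤ m + n → m + n ∸ o < m
m+n∸o<m {m} {n} {o} n<o o≤m+n = subst (m + n ∸ o <_) (m+n∸n≡m m o) (∸-monoˡ-< (+-monoʳ-< m n<o) o≤m+n)

module _ {r : ℕ} .{{_ : NonZero r}} where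

  _⊕_ : Fin r → Fin r → Fin r
  j ⊕ c = fromℕ< (m%n<n (toℕ j + toℕ c) r)

  toℕ-⊕-noWrap : ∀ j c → toℕ j + toℕ c < r → toℕ (j ⊕ c) ≡ toℕ j + toℕ c
  toℕ-⊕-noWrap j c j+c<r = trans (toℕ-fromℕ< (m%n<n (toℕ j + toℕ c) r)) (m<n⇒m%n≡m j+c<r)

  toℕ-⊕-wrap : ∀ j c → r ≤ toℕ j + toℕ c → toℕ (j ⊕ c) ≡ toℕ j + toℕ c ∸ r
  toℕ-⊕-wrap j c r≤j+c = begin
    toℕ (j ⊕ c)              ≡⟨ toℕ-fromℕ< (m%n<n (toℕ j + toℕ c) r) ⟩
    (toℕ j + toℕ c) % r      ≡⟨ m≤n⇒[n∸m]%m≡n%m r≤j+c ⟨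
    (toℕ j + toℕ c ∸ r) % r  ≡⟨ m<n⇒m%n≡m (<-trans (m+n∸o<m (toℕ<n c) r≤j+c) (toℕ<n j)) ⟩
    toℕ j + toℕ c ∸ r        ∎
    where open ≡-Reasoning

  wrap⇒⊕< : ∀ j c → r ≤ toℕ j + toℕ c → j ⊕ c Fin.< j
  wrap⇒⊕< j c r≤j+c = subst (_< toℕ j) (sym (toℕ-⊕-wrap j c r≤j+c)) (m+n∸o<m (toℕ<n c) r≤j+c)

  ⊕<⇒wrap : ∀ j c → j ⊕ c Fin.< j → r ≤ toℕ j + toℕ c
  ⊕<⇒wrap j c j⊕c<j with r ≤? toℕ j + toℕ c
  ... | yes r≤j+c = r≤j+c
  ... | no r≰j+c  = contradiction (subst (_< toℕ j) (toℕ-⊕-noWrap j c (≰⇒> r≰j+c)) j⊕c<j)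
                                  (m+n≮m (toℕ j) (toℕ c))

  ⊕-identityʳ : ∀ j c → toℕ c ≡ 0 → j ⊕ c ≡ j
  ⊕-identityʳ j c c≡0 = toℕ-injective (begin
    toℕ (j ⊕ c)      ≡⟨ toℕ-⊕-noWrap j c j+c<r ⟩
    toℕ j + toℕ c    ≡⟨ cong (toℕ j +_) c≡0 ⟩
    toℕ j + 0        ≡⟨ +-identityʳ (toℕ j) ⟩
    toℕ j            ∎)
    where
    open ≡-Reasoning
    j+c<r : toℕ j + toℕ c < r
    j+c<r = subst (_< r) (sym (trans (cong (toℕ j +_) c≡0) (+-identityʳ (toℕ j)))) (toℕ<n j)

  ⊕-fixed⇒zero : ∀ j c → j ≡ j ⊕ c → toℕ c ≡ 0
  ⊕-fixed⇒zero j c j≡j⊕c with r ≤? toℕ j + toℕ c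
  ... | yes r≤j+c = contradiction (wrap⇒⊕< j c r≤j+c) (<-irrefl (cong toℕ (sym j≡j⊕c)))
  ... | no r≰j+c  = +-cancelˡ-≡ (toℕ j) (toℕ c) 0 (begin
    toℕ j + toℕ c    ≡⟨ toℕ-⊕-noWrap j c (≰⇒> r≰j+c) ⟨
    toℕ (j ⊕ c)      ≡⟨ cong toℕ j≡j⊕c ⟨
    toℕ j            ≡⟨ +-identityʳ (toℕ j) ⟨
    toℕ j + 0        ∎)
    where open ≡-Reasoning

module _ {r n : ℕ} .{{_ : NonZero r}} (z : Fin n → Fin r) (τ : Permutation′ n) where

  Rises : Fin n → Pred (Fin r) 0ℓ
  Rises i j = (i , j) <c act (z , τ) (i , j)

  rises? : (i : Fin n) → Decidable (Rises i)
  rises? i j = (i , j) <c? act (z , τ) (i , j)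

  -- Restates the filter predicate of excA, so that count excA? (allFin n) is excA (z , τ) by definition.
  ExcA : Pred (Fin n) 0ℓ
  ExcA i = (toℕ i < n ∸ 1) × ((i , fromℕ< (m%n<n 0 r)) <c actA (z , τ) i)

  excA? : Decidable ExcA
  excA? i = (toℕ i <? n ∸ 1) ×-dec ((i , fromℕ< (m%n<n 0 r)) <c? actA (z , τ) i)

  toℕ-colour₀ : toℕ (fromℕ< (m%n<n 0 r)) ≡ 0
  toℕ-colour₀ = trans (toℕ-fromℕ< (m%n<n 0 r)) (m<n⇒m%n≡m (>-nonZero⁻¹ r))

  ExcA⇒zi≡0∧i<τi : ∀ {i} → ExcA i → toℕ (z i) ≡ 0 × i Fin.< τ ⟨$⟩ʳ i
  ExcA⇒zi≡0∧i<τi {i} (_ , inj₁ zi<0)          = contradiction (subst (toℕ (z i) <_) toℕ-colour₀ zi<0) n≮0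
  ExcA⇒zi≡0∧i<τi     (_ , inj₂ (0≡zi , i<τi)) = trans (cong toℕ (sym 0≡zi)) toℕ-colour₀ , i<τi

  zi≡0∧i<τi⇒ExcA : ∀ {i} → toℕ (z i) ≡ 0 → i Fin.< τ ⟨$⟩ʳ i → ExcA i
  zi≡0∧i<τi⇒ExcA {i} zi≡0 i<τi =
    <-≤-trans i<τi (∸-monoˡ-≤ 1 (toℕ<n (τ ⟨$⟩ʳ i))) ,
    inj₂ (toℕ-injective (trans toℕ-colour₀ (sym zi≡0)) , i<τi)

  count-rises : ∀ i → count (rises? i) (allFin r) ≡ r * count excA? [ i ] + toℕ (z i)
  count-rises i with toℕ (z i) ≟ 0
  ... | yes zi≡0 = begin
    count (rises? i) (allFin r)        ≡⟨ count-allFin-const (rises? i) excA? rises⇒ExcA ExcA⇒rises ⟩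
    r * count excA? [ i ]              ≡⟨ +-identityʳ _ ⟨
    r * count excA? [ i ] + 0          ≡⟨ cong (r * count excA? [ i ] +_) zi≡0 ⟨
    r * count excA? [ i ] + toℕ (z i)  ∎
    where
    open ≡-Reasoning
    rises⇒ExcA : ∀ j → Rises i j → ExcA i
    rises⇒ExcA j (inj₁ j⊕zi<j)      = contradiction j⊕zi<j (<-irrefl (cong toℕ (⊕-identityʳ j (z i) zi≡0)))
    rises⇒ExcA j (inj₂ (_ , i<τi)) = zi≡0∧i<τi⇒ExcA zi≡0 i<τi
    ExcA⇒rises : ∀ j → ExcA i → Rises i j
    ExcA⇒rises j e = inj₂ (sym (⊕-identityʳ j (z i) zi≡0) , proj₂ (ExcA⇒zi≡0∧i<τi e))
  ... | no zi≢0 = begin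
    count (rises? i) (allFin r)        ≡⟨ count-≐ (rises? i) wraps? (rises⇒wraps , wraps⇒rises) (allFin r) ⟩
    count wraps? (allFin r)            ≡⟨ count-wraps r (toℕ (z i)) (<⇒≤ (toℕ<n (z i))) ⟩
    toℕ (z i)                          ≡⟨ cong (_+ toℕ (z i)) r*[excA]≡0 ⟨
    r * count excA? [ i ] + toℕ (z i)  ∎
    where
    open ≡-Reasoning
    wraps? : Decidable (λ (j : Fin r) → r ≤ toℕ j + toℕ (z i))
    wraps? j = r ≤? toℕ j + toℕ (z i)
    rises⇒wraps : ∀ {j} → Rises i j → r ≤ toℕ j + toℕ (z i)
    rises⇒wraps {j} (inj₁ j⊕zi<j)       = ⊕<⇒wrap j (z i) j⊕zi<j
    rises⇒wraps {j} (inj₂ (j≡j⊕zi , _)) = contradiction (⊕-fixed⇒zero j (z i) j≡j⊕zi) zi≢0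
    wraps⇒rises : ∀ {j} → r ≤ toℕ j + toℕ (z i) → Rises i j
    wraps⇒rises {j} r≤j+zi = inj₁ (wrap⇒⊕< j (z i) r≤j+zi)
    r*[excA]≡0 : r * count excA? [ i ] ≡ 0
    r*[excA]≡0 = trans (cong (r *_) (count-[x]-no excA? (zi≢0 ∘ proj₁ ∘ ExcA⇒zi≡0∧i<τi))) (*-zeroʳ r)

mainTheorem5 : (r n : ℕ) .{{_ : NonZero r}} → 1 ≤ n → (σ : G r n) →
    excΣ σ ≡ r * excA σ + csum σ
mainTheorem5 r n _ (z , τ) =
  count-cartesianProduct _ (excA? z τ) r (toℕ ∘ z) (allFin r) fibre (allFin n)
  where
  fibre : ∀ i → count (λ x → x <c? act (z , τ) x) (map (i ,_) (allFin r)) ≡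
                r * count (excA? z τ) [ i ] + toℕ (z i)
  fibre i = trans (count-map _ (i ,_) (allFin r)) (count-rises z τ i)
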